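{- Let $\Gamma$ be a maximal $\mathbb{SKHM}$-consistent set and $\mathcal{M}^c_\Gamma$ its canonical model. Let $w\in S^c$ and let $a\in\Sigma_\Gamma$ be of the form $\langle\psi,\bot,\phi'\rangle$ or $\langle\chi^\psi,\phi'\rangle$, with $a$ executable at $w$ (i.e. $w$ has some $a$-successor). If $\phi\in L(w')$ for every $w'$ with $w\xrightarrow{a}w'$, then $\mathcal{U}(\phi'\to\phi)\in\Gamma$.
   Context: Formulas: $\phi::=p\mid\neg\phi\mid(\phi\wedge\phi)\mid \mathcal{K}hm(\phi,\phi,\phi)$ over countable $\mathbf{P}$; $\mathcal{U}\phi$ abbreviates $\mathcal{K}hm(\neg\phi,\top,\bot)$. The system $\mathbb{SKHM}$ (with $p,q,r,o,p',q',o'$ proposition letters) has axioms: TAUT all propositional tautologies; DISTU $\mathcal{U}p\wedge\mathcal{U}(p\to q)\to\mathcal{U}q$; TU $\mathcal{U}p\to p$; 4KhmU $\mathcal{K}hm(p,o,q)\to\mathcal{U}\mathcal{K}hm(p,o,q)$; 5KhmU $\neg\mathcal{K}hm(p,o,q)\to\mathcal{U}\neg\mathcal{K}hm(p,o,q)$; EMPKhm $\mathcal{U}(p\to q)\to\mathcal{K}hm(p,\bot,q)$; COMPKhm $\mathcal{K}hm(p,o,r)\wedge\mathcal{K}hm(r,o,q)\wedge\mathcal{U}(r\to o)\to\mathcal{K}hm(p,o,q)$; ONEKhm $\mathcal{K}hm(p,o,q)\wedge\neg\mathcal{K}hm(p,\bot,q)\to\mathcal{K}hm(p,\bot,o)$;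 UKhm $\mathcal{U}(p'\to p)\wedge\mathcal{U}(o\to o')\wedge\mathcal{U}(q\to q')\wedge\mathcal{K}hm(p,o,q)\to\mathcal{K}hm(p',o',q')$; rules MP, NECU, SUB. Canonical model: $\Phi_\Gamma$ is the set of maximal consistent $\Delta$ containing exactly the same $\mathcal{K}hm$-formulas as $\Gamma$. $\Sigma_\Gamma=\{\langle\psi,\bot,\phi\rangle\mid\mathcal{K}hm(\psi,\bot,\phi)\in\Gamma\}\cup\{\langle\chi^\psi,\phi\rangle\mid\mathcal{K}hm(\psi,\chi,\phi)\in\Gamma,\ \neg\mathcal{K}hm(\psi,\bot,\phi)\in\Gamma\}$ (formal symbols; $\chi^\psi$ is a formal marker). $S^c$ is the set of pairs $w=(\Delta,\chi^\psi)$ with $\chi\in\Delta\in\Phi_\Gamma$ such that $\langle\chi^\psi,\phi\rangle\in\Sigma_\Gamma$ for some $\phi$ or $\langle\psi,\bot,\chi\rangle\in\Sigma_\Gamma$; $L(w)=\Delta$, $R(w)=\chi^\psi$. Transitions: $w\xrightarrow{\langle\psi,\bot,\phi\rangle}w'$ iff $\psi\in L(w)$ and $R(w')=\phi^\psi$; $w\xrightarrow{\langle\chi^\psi,\phi\rangle}w'$ iff $R(w)=\chi^\psi$ and $\phi\in L(w')$; $p\in V^c(w)$ iff $p\in L(w)$. -}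

module Defs where

open import Data.Nat using (ℕ)
open import Data.Bool using (Bool; true; false; not; _∧_)
open import Data.List using (List; []; _∷_)
open import Data.List.Relation.Unary.All using (All)
open import Data.Product using (Σ; _×_; _,_)
open import Data.Sum using (_⊎_)
open import Data.Empty using (⊥)
open import Relation.Nullary using (¬_)
open import Relation.Binary.PropositionalEquality using (_≡_)
open import Function.Bundles using (_⇔_)

data Form : Set where
  var  : ℕ → Form
  ~_   : Form → Form
  _&_  : Form → Form → Form
  Khm  : Form → Form → Form → Form

infixr 6 _&_
infixr 4 _⇒_
infix  7 ~_
infix  3 ⊢_

_⇒_ : Form → Form → Form
φ ⇒ ψ = ~ (φ & ~ ψ)

⊤F : Form
⊤F = ~ (var 0 & ~ var 0)

⊥F : Form
⊥F = ~ ⊤F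

U : Form → Form
U φ = Khm (~ φ) ⊤F ⊥F

eval : (Form → Bool) → Form → Bool
eval v (var p)     = v (var p)
eval v (~ φ)       = not (eval v φ)
eval v (φ & ψ)     = eval v φ ∧ eval v ψ
eval v (Khm a b c) = v (Khm a b c)

Taut : Form → Set
Taut φ = (v : Form → Bool) → eval v φ ≡ true

sub : (ℕ → Form) → Form → Form
sub σ (var p)     = σ p
sub σ (~ φ)       = ~ sub σ φ
sub σ (φ & ψ)     = sub σ φ & sub σ ψ
sub σ (Khm a b c) = Khm (sub σ a) (sub σ b) (sub σ c)

p q r o p' q' o' : Form
p  = var 0
q  = var 1
r  = var 2
o  = var 3
p' = var 4
q' = var 5
o' = var 6

data ⊢_ : Form → Set where
  TAUT   : ∀ {φ} → Taut φ → ⊢ φ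
  DISTU  : ⊢ ((U p & U (p ⇒ q)) ⇒ U q)
  TU     : ⊢ (U p ⇒ p)
  4KhmU  : ⊢ (Khm p o q ⇒ U (Khm p o q))
  5KhmU  : ⊢ (~ Khm p o q ⇒ U (~ Khm p o q))
  EMPKhm : ⊢ (U (p ⇒ q) ⇒ Khm p ⊥F q)
  COMPKhm : ⊢ ((Khm p o r & Khm r o q & U (r ⇒ o)) ⇒ Khm p o q)
  ONEKhm : ⊢ ((Khm p o q & ~ Khm p ⊥F q) ⇒ Khm p ⊥F o)
  UKhm   : ⊢ ((U (p' ⇒ p) & U (o ⇒ o') & U (q ⇒ q') & Khm p o q) ⇒ Khm p' o' q')
  MP     : ∀ {φ ψ} → ⊢ φ → ⊢ (φ ⇒ ψ) → ⊢ ψ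
  NECU   : ∀ {φ} → ⊢ φ → ⊢ U φ
  SUB    : ∀ {φ} (σ : ℕ → Form) → ⊢ φ → ⊢ sub σ φ

FSet : Set₁
FSet = Form → Set

conj : List Form → Form
conj []       = ⊤F
conj (φ ∷ l)  = φ & conj l

Consistent : FSet → Set
Consistent Δ = ¬ (Σ (List Form) λ l → All Δ l × ⊢ ~ conj l)

MaxCons : FSet → Set₁
MaxCons Δ = Consistent Δ ×
  ((Θ : FSet) → (∀ φ → Δ φ → Θ φ) → Consistent Θ → ∀ φ → Θ φ → Δ φ)

module Canonical (Γ : FSet) where

  InΦ : FSet → Set₁
  InΦ Δ = MaxCons Δ × (∀ a b c → Δ (Khm a b c) ⇔ Γ (Khm a b c))

  -- Σ_Γ labels:  tri ψ φ = ⟨ψ,⊥,φ⟩ ;  mark χ ψ φ = ⟨χ^ψ, φ⟩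
  data Label : Set where
    tri  : Form → Form → Label
    mark : Form → Form → Form → Label

  InΣ : Label → Set
  InΣ (tri ψ φ)    = Γ (Khm ψ ⊥F φ)
  InΣ (mark χ ψ φ) = Γ (Khm ψ χ φ) × Γ (~ Khm ψ ⊥F φ)

  target : Label → Form
  target (tri ψ φ)    = φ
  target (mark χ ψ φ) = φ

  -- a formal marker χ^ψ, represented as the pair (χ , ψ)
  Marker : Set
  Marker = Form × Form

  -- states w = (Δ, χ^ψ) of S^c
  record State : Set₁ where
    field
      L     : FSet
      L∈Φ   : InΦ L
      χ     : Form
      ψ     : Form
      χ∈L   : L χ
      ok    : (Σ Form λ φ → InΣ (mark χ ψ φ)) ⊎ InΣ (tri ψ χ)

  R : State → Marker
  R w = State.χ w , State.ψ w

  open State public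

  Step : State → Label → State → Set
  Step w (tri ψ φ)    w' = L w ψ × R w' ≡ (φ , ψ)
  Step w (mark χ ψ φ) w' = R w ≡ (χ , ψ) × L w' φ

  Vc : State → ℕ → Set
  Vc w n = L w (var n)

-- Once a is executable at w, every Δ ∈ Φ_Γ containing φ′ is L(w′) for some a-successor w′ of w.
-- If 𝒰(φ′ → φ) ∉ Γ, then {X ∣ 𝒰X ∈ Γ} ∪ {φ′ ∧ ¬φ} is consistent, and a Lindenbaum extension Δ of it
-- lies in Φ_Γ, since 4KhmU and 5KhmU put every Khm-literal of Γ under 𝒰.  The a-successor with
-- L(w′) = Δ then contains ¬φ, contradicting φ ∈ L(w′).
module Submission where

open import Defs
open import Data.Bool using (Bool; true; false; not; _∧_; T)
open import Data.Bool.Properties using (T-∧; T-≡)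
open import Data.Empty using (⊥)
open import Data.Fin using (Fin; zero; suc)
open import Data.List using (List; []; _∷_)
open import Data.List.Relation.Unary.All as All using (All; []; _∷_)
open import Data.Nat using (ℕ; zero; suc; _+_; _⊔_; _≤_; s≤s⁻¹)
open import Data.Nat.Properties using (+-suc; +-identityʳ; +-comm; suc-injective; ≤-refl; m⊔n≤o⇒m≤o; m⊔n≤o⇒n≤o)
open import Data.Product as Product using (Σ; ∃; _×_; _,_; proj₁; proj₂; map₂)
open import Data.Sum using (_⊎_; inj₁; inj₂)
open import Data.Vec using (Vec; []; _∷_; lookup; map)
open import Data.Vec.Properties using (lookup-map)
open import Function using (_∘_)
open import Function.Bundles using (Equivalence; mk⇔)
open import Relation.Binary.PropositionalEquality using (_≡_; refl; sym; trans; cong; cong₂; subst)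
open import Relation.Nullary using (¬_)
open import Relation.Unary using (_∈_; _∉_; _∪_; ｛_｝; _⊆_)

variable
  n : ℕ
  A B C : Form
  Δ Θ : FSet
  l : List Form

data Schema (n : ℕ) : Set where
  ‵_   : Fin n → Schema n
  ~ₛ_  : Schema n → Schema n
  _&ₛ_ : Schema n → Schema n → Schema n

infix  7 ~ₛ_
infixr 6 _&ₛ_
infixr 4 _⇒ₛ_

_⇒ₛ_ : Schema n → Schema n → Schema n
S ⇒ₛ S′ = ~ₛ (S &ₛ ~ₛ S′)

x₀ : Schema (suc n)
x₀ = ‵ zero

x₁ : Schema (suc (suc n))
x₁ = ‵ suc zero

x₂ : Schema (suc (suc (suc n)))
x₂ = ‵ suc (suc zero)

x₃ : Schema (suc (suc (suc (suc n))))
x₃ = ‵ suc (suc (suc zero))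

_⟦_⟧ : Schema n → Vec Form n → Form
(‵ i)    ⟦ ρ ⟧ = lookup ρ i
(~ₛ S)   ⟦ ρ ⟧ = ~ S ⟦ ρ ⟧
(S &ₛ S′) ⟦ ρ ⟧ = S ⟦ ρ ⟧ & S′ ⟦ ρ ⟧

truth : Vec Bool n → Schema n → Bool
truth β (‵ i)     = lookup β i
truth β (~ₛ S)    = not (truth β S)
truth β (S &ₛ S′) = truth β S ∧ truth β S′

eval-⟦⟧ : ∀ v (ρ : Vec Form n) S → eval v (S ⟦ ρ ⟧) ≡ truth (map (eval v) ρ) S
eval-⟦⟧ v ρ (‵ i)     = sym (lookup-map i (eval v) ρ)
eval-⟦⟧ v ρ (~ₛ S)    = cong not (eval-⟦⟧ v ρ S)
eval-⟦⟧ v ρ (S &ₛ S′) = cong₂ _∧_ (eval-⟦⟧ v ρ S) (eval-⟦⟧ v ρ S′)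

every : ∀ n → (Vec Bool n → Bool) → Bool
every zero    f = f []
every (suc n) f = every n (f ∘ (true ∷_)) ∧ every n (f ∘ (false ∷_))

every-sound : ∀ n f → T (every n f) → ∀ β → T (f β)
every-sound zero    f holds []          = holds
every-sound (suc n) f holds (true ∷ β)  = every-sound n _ (proj₁ (Equivalence.to T-∧ holds)) β
every-sound (suc n) f holds (false ∷ β) = every-sound n _ (proj₂ (Equivalence.to T-∧ holds)) β

-- The implicit argument is a truth-table check, discharged by evaluation.
taut : (ρ : Vec Form n) (S : Schema n) {_ : T (every n (λ β → truth β S))} → ⊢ S ⟦ ρ ⟧
taut ρ S {valid} = TAUT λ v →
  trans (eval-⟦⟧ v ρ S) (Equivalence.to T-≡ (every-sound _ _ valid (map (eval v) ρ)))

MP₂ : ⊢ A → ⊢ B → ⊢ (A ⇒ B ⇒ C) → ⊢ C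
MP₂ a b a⇒b⇒c = MP b (MP a a⇒b⇒c)

⇒-curry : ⊢ ((A & B) ⇒ C) → ⊢ (A ⇒ B ⇒ C)
⇒-curry {A} {B} {C} d = MP d (taut (A ∷ B ∷ C ∷ []) ((x₀ &ₛ x₁ ⇒ₛ x₂) ⇒ₛ x₀ ⇒ₛ x₁ ⇒ₛ x₂))

⇒-trans : ⊢ (A ⇒ B) → ⊢ (B ⇒ C) → ⊢ (A ⇒ C)
⇒-trans {A} {B} {C} d e = MP₂ d e (taut (A ∷ B ∷ C ∷ []) ((x₀ ⇒ₛ x₁) ⇒ₛ (x₁ ⇒ₛ x₂) ⇒ₛ x₀ ⇒ₛ x₂))

sub-∘ : ∀ σ τ φ → sub τ (sub σ φ) ≡ sub (sub τ ∘ σ) φ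
sub-∘ σ τ (var m)     = refl
sub-∘ σ τ (~ φ)       = cong ~_ (sub-∘ σ τ φ)
sub-∘ σ τ (φ & ψ)     = cong₂ _&_ (sub-∘ σ τ φ) (sub-∘ σ τ ψ)
sub-∘ σ τ (Khm φ ψ χ) rewrite sub-∘ σ τ φ | sub-∘ σ τ ψ | sub-∘ σ τ χ = refl

sub-var : ∀ φ → sub var φ ≡ φ
sub-var (var m)     = refl
sub-var (~ φ)       = cong ~_ (sub-var φ)
sub-var (φ & ψ)     = cong₂ _&_ (sub-var φ) (sub-var ψ)
sub-var (Khm φ ψ χ) rewrite sub-var φ | sub-var ψ | sub-var χ = refl

-- ⊤F mentions letter 0, so substituting X for letter 0 turns ⊤F, ⊥F and U into the following;
-- U⟨ var 0 ⟩ is U itself.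
⊤⟨_⟩ ⊥⟨_⟩ : Form → Form
⊤⟨ X ⟩ = X ⇒ X
⊥⟨ X ⟩ = ~ ⊤⟨ X ⟩

U⟨_⟩ : Form → Form → Form
U⟨ X ⟩ φ = Khm (~ φ) ⊤⟨ X ⟩ ⊥⟨ X ⟩

shift : ℕ → Form
shift m = var (suc m)

unshift : Form → ℕ → Form
unshift X zero    = X
unshift X (suc m) = var m

-- Move φ off letter 0, necessitate, then put X at letter 0.
NECU⟨_⟩ : ∀ X {φ} → ⊢ φ → ⊢ U⟨ X ⟩ φ
NECU⟨ X ⟩ {φ} d = subst (λ ψ → ⊢ U⟨ X ⟩ ψ) (trans (sub-∘ shift (unshift X) φ) (sub-var φ))
  (SUB (unshift X) (NECU (SUB shift d)))

letters : Form → Form → Form → Form → Form → Form → Form → ℕ → Form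
letters P Q R O P′ Q′ O′ 0 = P
letters P Q R O P′ Q′ O′ 1 = Q
letters P Q R O P′ Q′ O′ 2 = R
letters P Q R O P′ Q′ O′ 3 = O
letters P Q R O P′ Q′ O′ 4 = P′
letters P Q R O P′ Q′ O′ 5 = Q′
letters P Q R O P′ Q′ O′ 6 = O′
letters _ _ _ _ _ _ _ _ = var 0

DISTU⟨_⟩ : ∀ A {B} → ⊢ (U⟨ A ⟩ A ⇒ U⟨ A ⟩ (A ⇒ B) ⇒ U⟨ A ⟩ B)
DISTU⟨ A ⟩ {B} = ⇒-curry (SUB (letters A B A A A A A) DISTU)

EMPKhm⟨_⟩ : ∀ P {Q} → ⊢ (U⟨ P ⟩ (P ⇒ Q) ⇒ Khm P ⊥⟨ P ⟩ Q)
EMPKhm⟨ P ⟩ {Q} = SUB (letters P Q P P P P P) EMPKhm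

UKhm-rule : ∀ {P P′ O O′ Q Q′} → ⊢ U⟨ P ⟩ (P′ ⇒ P) → ⊢ U⟨ P ⟩ (O ⇒ O′) → ⊢ U⟨ P ⟩ (Q ⇒ Q′) →
  ⊢ (Khm P O Q ⇒ Khm P′ O′ Q′)
UKhm-rule {P} {P′} {O} {O′} {Q} {Q′} p′⇒p o⇒o′ q⇒q′ =
  MP q⇒q′ (⇒-curry (MP o⇒o′ (⇒-curry (MP p′⇒p (⇒-curry (SUB (letters P Q P O P′ Q′ O′) UKhm))))))

U⟨⟩-change : ∀ X Y φ → ⊢ (U⟨ X ⟩ φ ⇒ U⟨ Y ⟩ φ)
U⟨⟩-change X Y φ = UKhm-rule
  (NECU⟨ ~ φ ⟩ (taut (φ ∷ []) (~ₛ x₀ ⇒ₛ ~ₛ x₀)))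
  (NECU⟨ ~ φ ⟩ (taut (X ∷ Y ∷ []) ((x₀ ⇒ₛ x₀) ⇒ₛ (x₁ ⇒ₛ x₁))))
  (NECU⟨ ~ φ ⟩ (taut (X ∷ Y ∷ []) (~ₛ (x₀ ⇒ₛ x₀) ⇒ₛ ~ₛ (x₁ ⇒ₛ x₁))))

Khm⇒U-Khm : ∀ P O Q → ⊢ (Khm P O Q ⇒ U (Khm P O Q))
Khm⇒U-Khm P O Q = ⇒-trans (SUB (letters P Q P O P P P) 4KhmU) (U⟨⟩-change P (var 0) _)

¬Khm⇒U-¬Khm : ∀ P O Q → ⊢ (~ Khm P O Q ⇒ U (~ Khm P O Q))
¬Khm⇒U-¬Khm P O Q = ⇒-trans (SUB (letters P Q P O P P P) 5KhmU) (U⟨⟩-change P (var 0) _)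

Khm-refl : ∀ P → ⊢ Khm P ⊥F P
Khm-refl P = MP (MP U⟨P⟩P⇒P EMPKhm⟨ P ⟩)
  (UKhm-rule U⟨P⟩P⇒P (NECU⟨ P ⟩ (taut (P ∷ var 0 ∷ []) (~ₛ (x₀ ⇒ₛ x₀) ⇒ₛ ~ₛ (x₁ ⇒ₛ x₁)))) U⟨P⟩P⇒P)
  where
  U⟨P⟩P⇒P : ⊢ U⟨ P ⟩ (P ⇒ P)
  U⟨P⟩P⇒P = NECU⟨ P ⟩ (taut (P ∷ []) (x₀ ⇒ₛ x₀))

Inconsistent : FSet → Set
Inconsistent Θ = Σ (List Form) λ l → All Θ l × ⊢ ~ conj l

remove-inserted : ∀ m → All (Θ ∪ ｛ B ｝) m → Σ (List Form) λ l → All Θ l × ⊢ (B & conj l ⇒ conj m)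
remove-inserted {B = B} [] [] = [] , [] , taut (B ∷ var 0 ∷ []) (x₀ &ₛ (x₁ ⇒ₛ x₁) ⇒ₛ x₁ ⇒ₛ x₁)
remove-inserted {B = B} (X ∷ m) (inj₁ X∈Θ ∷ ms) with remove-inserted m ms
... | l , ls , d = X ∷ l , X∈Θ ∷ ls ,
  MP d (taut (B ∷ conj l ∷ conj m ∷ X ∷ []) ((x₀ &ₛ x₁ ⇒ₛ x₂) ⇒ₛ x₀ &ₛ x₃ &ₛ x₁ ⇒ₛ x₃ &ₛ x₂))
remove-inserted {B = B} (X ∷ m) (inj₂ refl ∷ ms) with remove-inserted m ms
... | l , ls , d = l , ls ,
  MP d (taut (B ∷ conj l ∷ conj m ∷ []) ((x₀ &ₛ x₁ ⇒ₛ x₂) ⇒ₛ x₀ &ₛ x₁ ⇒ₛ x₀ &ₛ x₂))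

refute-inserted : Inconsistent (Θ ∪ ｛ B ｝) → Σ (List Form) λ l → All Θ l × ⊢ (conj l ⇒ ~ B)
refute-inserted {B = B} (m , ms , ⊢¬m) with remove-inserted m ms
... | l , ls , d = l , ls ,
  MP₂ d ⊢¬m (taut (B ∷ conj l ∷ conj m ∷ []) ((x₀ &ₛ x₁ ⇒ₛ x₂) ⇒ₛ ~ₛ x₂ ⇒ₛ x₁ ⇒ₛ ~ₛ x₀))

𝒰-theory : FSet → FSet
𝒰-theory Γ X = U X ∈ Γ

module _ (mc : MaxCons Δ) where

  ∈-of-insert-consistent : Consistent (Δ ∪ ｛ B ｝) → B ∈ Δ
  ∈-of-insert-consistent {B} consistent = proj₂ mc _ (λ _ → inj₁) consistent B (inj₂ refl)

  ∈-theorem : ⊢ B → B ∈ Δ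
  ∈-theorem {B} ⊢B = ∈-of-insert-consistent λ inconsistent →
    let l , ls , d = refute-inserted inconsistent in
    proj₁ mc (l , ls , MP₂ ⊢B d (taut (B ∷ conj l ∷ []) (x₀ ⇒ₛ (x₁ ⇒ₛ ~ₛ x₀) ⇒ₛ ~ₛ x₁)))

  ∈-MP : A ∈ Δ → (A ⇒ B) ∈ Δ → B ∈ Δ
  ∈-MP {A} {B} a a⇒b = ∈-of-insert-consistent λ inconsistent →
    let l , ls , d = refute-inserted inconsistent in
    proj₁ mc (A ∷ (A ⇒ B) ∷ l , a ∷ a⇒b ∷ ls ,
      MP d (taut (A ∷ B ∷ conj l ∷ []) ((x₂ ⇒ₛ ~ₛ x₁) ⇒ₛ ~ₛ (x₀ &ₛ (x₀ ⇒ₛ x₁) &ₛ x₂))))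

  ∈-closed : A ∈ Δ → ⊢ (A ⇒ B) → B ∈ Δ
  ∈-closed a d = ∈-MP a (∈-theorem d)

  ∈-closed₂ : A ∈ Δ → B ∈ Δ → ⊢ (A ⇒ B ⇒ C) → C ∈ Δ
  ∈-closed₂ a b d = ∈-MP b (∈-closed a d)

  conj∈ : All (_∈ Δ) l → conj l ∈ Δ
  conj∈ []                 = ∈-theorem (taut (var 0 ∷ []) (x₀ ⇒ₛ x₀))
  conj∈ {X ∷ l} (x ∷ xs)   = ∈-closed₂ x (conj∈ xs) (taut (X ∷ conj l ∷ []) (x₀ ⇒ₛ x₁ ⇒ₛ x₀ &ₛ x₁))

  ∈⇒~∉ : A ∈ Δ → ~ A ∉ Δ
  ∈⇒~∉ {A} a ¬a = proj₁ mc (A ∷ ~ A ∷ [] , a ∷ ¬a ∷ [] ,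
    taut (A ∷ var 0 ∷ []) (~ₛ (x₀ &ₛ ~ₛ x₀ &ₛ (x₁ ⇒ₛ x₁))))

  ∉⇒~∈ : A ∉ Δ → ~ A ∈ Δ
  ∉⇒~∈ {A} A∉Δ = ∈-of-insert-consistent λ inconsistent →
    let l , ls , d = refute-inserted inconsistent in
    A∉Δ (∈-closed (conj∈ ls) (MP d (taut (A ∷ conj l ∷ []) ((x₁ ⇒ₛ ~ₛ ~ₛ x₀) ⇒ₛ x₁ ⇒ₛ x₀))))

  ¬¬∈⇒∈ : ¬ ¬ A ∈ Δ → A ∈ Δ
  ¬¬∈⇒∈ ¬¬a = ∈-of-insert-consistent λ inconsistent →
    let l , ls , d = refute-inserted inconsistent in
    ¬¬a λ a → ∈⇒~∉ a (∈-closed (conj∈ ls) d)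

  -- DISTU is only available relative to A, so U is moved to U⟨ A ⟩ and back.
  U-MP∈ : U A ∈ Δ → U (A ⇒ B) ∈ Δ → U B ∈ Δ
  U-MP∈ {A} {B} uA uA⇒B = ∈-closed
    (∈-closed₂ (∈-closed uA (U⟨⟩-change (var 0) A A)) (∈-closed uA⇒B (U⟨⟩-change (var 0) A (A ⇒ B)))
      DISTU⟨ A ⟩)
    (U⟨⟩-change A (var 0) B)

  U-mono∈ : U A ∈ Δ → ⊢ (A ⇒ B) → U B ∈ Δ
  U-mono∈ uA d = U-MP∈ uA (∈-theorem (NECU d))

  U-conj∈ : All (𝒰-theory Δ) l → U (conj l) ∈ Δ
  U-conj∈ []               = ∈-theorem (NECU (taut (var 0 ∷ []) (x₀ ⇒ₛ x₀)))
  U-conj∈ {X ∷ l} (u ∷ us) =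
    U-MP∈ (U-conj∈ us) (U-mono∈ u (taut (X ∷ conj l ∷ []) (x₀ ⇒ₛ x₁ ⇒ₛ x₀ &ₛ x₁)))

  𝒰-theory-insert-consistent : U (~ A) ∉ Δ → Consistent (𝒰-theory Δ ∪ ｛ A ｝)
  𝒰-theory-insert-consistent U¬A∉Δ inconsistent =
    let l , us , d = refute-inserted inconsistent in U¬A∉Δ (U-mono∈ (U-conj∈ us) d)

-- Cantor's enumeration of ℕ × ℕ along the anti-diagonals.
zigzag : ℕ × ℕ → ℕ × ℕ
zigzag (a , zero)  = zero , suc a
zigzag (a , suc b) = suc a , b

unpair : ℕ → ℕ × ℕ
unpair zero    = zero , zero
unpair (suc m) = zigzag (unpair m)

unpair-onto-diagonal : ∀ s a b → a + b ≡ s → ∃ λ m → unpair m ≡ (a , b)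
unpair-onto-diagonal s zero zero _ = zero , refl
unpair-onto-diagonal s (suc a) b a+b≡s =
  Product.map suc (cong zigzag) (unpair-onto-diagonal s a (suc b) (trans (+-suc a b) a+b≡s))
unpair-onto-diagonal (suc s) zero (suc b) b+1≡s+1 =
  Product.map suc (cong zigzag) (unpair-onto-diagonal s b zero (trans (+-identityʳ b) (suc-injective b+1≡s+1)))

unpair-surjective : ∀ a b → ∃ λ m → unpair m ≡ (a , b)
unpair-surjective a b = unpair-onto-diagonal (a + b) a b refl

untriple : ℕ → ℕ × ℕ × ℕ
untriple m = proj₁ (unpair m) , unpair (proj₂ (unpair m))

untriple-surjective : ∀ a b c → ∃ λ m → untriple m ≡ (a , b , c)
untriple-surjective a b c with unpair-surjective b c
... | k , refl = map₂ (cong λ (a , k) → a , unpair k) (unpair-surjective a k)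

-- The fuel f bounds the depth of the decoded formula; the first component of unpair is the constructor tag.
mutual
  decode : ℕ → ℕ → Form
  decode zero    _ = var 0
  decode (suc f) m = node f (unpair m)

  node : ℕ → ℕ × ℕ → Form
  node f (0 , m) = var m
  node f (1 , m) = ~ decode f m
  node f (2 , m) = decode f (proj₁ (unpair m)) & decode f (proj₂ (unpair m))
  node f (suc (suc (suc _)) , m) =
    Khm (decode f (proj₁ (untriple m))) (decode f (proj₁ (proj₂ (untriple m)))) (decode f (proj₂ (proj₂ (untriple m))))

depth : Form → ℕ
depth (var _)     = 1
depth (~ φ)       = suc (depth φ)
depth (φ & ψ)     = suc (depth φ ⊔ depth ψ)
depth (Khm φ ψ χ) = suc (depth φ ⊔ (depth ψ ⊔ depth χ))

node-decoded : ∀ f t m → ∃ λ k → decode (suc f) k ≡ node f (t , m)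
node-decoded f t m = map₂ (cong (node f)) (unpair-surjective t m)

decode-complete : ∀ φ f → depth φ ≤ f → ∃ λ m → decode f m ≡ φ
decode-complete (var m) (suc f) _ = node-decoded f 0 m
decode-complete (~ φ) (suc f) d≤f with decode-complete φ f (s≤s⁻¹ d≤f)
... | i , refl = node-decoded f 1 i
decode-complete (φ & ψ) (suc f) d≤f
  with decode-complete φ f (m⊔n≤o⇒m≤o _ _ (s≤s⁻¹ d≤f)) | decode-complete ψ f (m⊔n≤o⇒n≤o _ _ (s≤s⁻¹ d≤f))
... | i , refl | j , refl with unpair-surjective i j
... | m , e = map₂ (λ eq → trans eq (cong (λ (i , j) → decode f i & decode f j) e)) (node-decoded f 2 m)
decode-complete (Khm φ ψ χ) (suc f) d≤f
  with decode-complete φ f (m⊔n≤o⇒m≤o _ _ (s≤s⁻¹ d≤f))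
     | decode-complete ψ f (m⊔n≤o⇒m≤o _ _ (m⊔n≤o⇒n≤o (depth φ) _ (s≤s⁻¹ d≤f)))
     | decode-complete χ f (m⊔n≤o⇒n≤o _ _ (m⊔n≤o⇒n≤o (depth φ) _ (s≤s⁻¹ d≤f)))
... | i , refl | j , refl | k , refl with untriple-surjective i j k
... | m , e = map₂ (λ eq → trans eq (cong (λ (i , j , k) → Khm (decode f i) (decode f j) (decode f k)) e))
                   (node-decoded f 3 m)

enum : ℕ → Form
enum m = decode (proj₁ (unpair m)) (proj₂ (unpair m))

enum-surjective : ∀ φ → ∃ λ m → enum m ≡ φ
enum-surjective φ with decode-complete φ (depth φ) ≤-refl
... | k , e with unpair-surjective (depth φ) k
... | m , e′ = m , trans (cong (λ (f , k) → decode f k) e′) e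

consistent-⊆ : Θ ⊆ Δ → Consistent Δ → Consistent Θ
consistent-⊆ Θ⊆Δ consistent (l , ls , d) = consistent (l , All.map Θ⊆Δ ls , d)

module _ {Θ : FSet} (Θ-consistent : Consistent Θ) where

  stage : ℕ → FSet
  stage zero    = Θ
  stage (suc m) = stage m ∪ λ X → enum m ≡ X × Consistent (stage m ∪ ｛ enum m ｝)

  limit : FSet
  limit X = ∃ λ m → X ∈ stage m

  stage-⊆-+ : ∀ k {m} → stage m ⊆ stage (k + m)
  stage-⊆-+ zero    x = x
  stage-⊆-+ (suc k) x = inj₁ (stage-⊆-+ k x)

  in-one-stage : All limit l → ∃ λ m → All (_∈ stage m) l
  in-one-stage [] = zero , []
  in-one-stage {X ∷ _} ((m , x) ∷ xs) with in-one-stage xs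
  ... | k , ks = m + k , subst (λ s → X ∈ stage s) (+-comm k m) (stage-⊆-+ k x) ∷ All.map (stage-⊆-+ m) ks

  added-or-before : ∀ m → All (_∈ stage (suc m)) l →
    All (_∈ stage m) l ⊎ Consistent (stage m ∪ ｛ enum m ｝)
  added-or-before m [] = inj₁ []
  added-or-before m (inj₂ (_ , consistent) ∷ _) = inj₂ consistent
  added-or-before m (inj₁ x ∷ xs) with added-or-before m xs
  ... | inj₁ xs′       = inj₁ (x ∷ xs′)
  ... | inj₂ consistent = inj₂ consistent

  stage-⊆-insert : ∀ {m} → stage (suc m) ⊆ stage m ∪ ｛ enum m ｝
  stage-⊆-insert (inj₁ x)       = inj₁ x
  stage-⊆-insert (inj₂ (e , _)) = inj₂ e

  stage-consistent : ∀ m → Consistent (stage m)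
  stage-consistent zero = Θ-consistent
  stage-consistent (suc m) (l , ls , d) with added-or-before m ls
  ... | inj₁ ls′        = stage-consistent m (l , ls′ , d)
  ... | inj₂ consistent = consistent-⊆ (stage-⊆-insert {m}) consistent (l , ls , d)

  limit-maximal-consistent : MaxCons limit
  limit-maximal-consistent = consistent , maximal
    where
    consistent : Consistent limit
    consistent (l , ls , d) = let m , ms = in-one-stage ls in stage-consistent m (l , ms , d)
    maximal : (Δ : FSet) → (∀ X → limit X → Δ X) → Consistent Δ → ∀ X → Δ X → limit X
    maximal Δ limit⊆Δ Δ-consistent X X∈Δ with enum-surjective X
    ... | m , refl = suc m , inj₂ (refl , consistent-⊆ insert⊆Δ Δ-consistent)
      where
      insert⊆Δ : stage m ∪ ｛ enum m ｝ ⊆ Δ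
      insert⊆Δ (inj₁ y)    = limit⊆Δ _ (m , y)
      insert⊆Δ (inj₂ refl) = X∈Δ

  lindenbaum : Σ FSet λ Δ → MaxCons Δ × Θ ⊆ Δ
  lindenbaum = limit , limit-maximal-consistent , λ x → zero , x

module _ {Γ : FSet} (mcΓ : MaxCons Γ) where
  open Canonical Γ

  ⊇𝒰-theory⇒InΦ : MaxCons Δ → 𝒰-theory Γ ⊆ Δ → InΦ Δ
  ⊇𝒰-theory⇒InΦ {Δ} mcΔ 𝒰Γ⊆Δ = mcΔ , λ P O Q → mk⇔ (Δ⇒Γ P O Q) (Γ⇒Δ P O Q)
    where
    Γ⇒Δ : ∀ P O Q → Khm P O Q ∈ Γ → Khm P O Q ∈ Δ
    Γ⇒Δ P O Q k = 𝒰Γ⊆Δ (∈-closed mcΓ k (Khm⇒U-Khm P O Q))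
    Δ⇒Γ : ∀ P O Q → Khm P O Q ∈ Δ → Khm P O Q ∈ Γ
    Δ⇒Γ P O Q k = ¬¬∈⇒∈ mcΓ λ k∉Γ →
      ∈⇒~∉ mcΔ k (𝒰Γ⊆Δ (∈-closed mcΓ (∉⇒~∈ mcΓ k∉Γ) (¬Khm⇒U-¬Khm P O Q)))

  successor-with-L : ∀ w a → InΣ a → Σ State (Step w a) → InΦ Δ → target a ∈ Δ →
    Σ State λ w′ → Step w a w′ × L w′ ≡ Δ
  successor-with-L w (tri ψ φ) a∈Σ (_ , ψ∈Lw , _) Δ∈Φ φ∈Δ =
    record { L = _ ; L∈Φ = Δ∈Φ ; χ = φ ; ψ = ψ ; χ∈L = φ∈Δ ; ok = inj₂ a∈Σ } , (ψ∈Lw , refl) , refl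
  -- The marker of w′ is irrelevant here; φ^φ is a state because Khm(φ, ⊥, φ) is a theorem.
  successor-with-L w (mark χ ψ φ) _ (_ , Rw≡χψ , _) Δ∈Φ φ∈Δ =
    record { L = _ ; L∈Φ = Δ∈Φ ; χ = φ ; ψ = φ ; χ∈L = φ∈Δ ; ok = inj₂ (∈-theorem mcΓ (Khm-refl φ)) } ,
    (Rw≡χψ , φ∈Δ) , refl

proposition11 : (Γ : FSet) → MaxCons Γ →
    let open Canonical Γ in
    (w : State) (a : Label) (φ : Form) → InΣ a →
    Σ State (λ w₀ → Step w a w₀) →
    ((w' : State) → Step w a w' → L w' φ) →
    Γ (U (target a ⇒ φ))
proposition11 Γ mcΓ w a φ a∈Σ a-executable φ-at-successors =
  ¬¬∈⇒∈ mcΓ λ U∉Γ → refute (lindenbaum (𝒰-theory-insert-consistent mcΓ U∉Γ))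
  where
  open Canonical Γ
  refute : (Σ FSet λ Δ → MaxCons Δ × 𝒰-theory Γ ∪ ｛ target a & ~ φ ｝ ⊆ Δ) → ⊥
  refute (Δ , mcΔ , Θ⊆Δ)
    with successor-with-L mcΓ w a a∈Σ a-executable (⊇𝒰-theory⇒InΦ mcΓ mcΔ (Θ⊆Δ ∘ inj₁))
           (∈-closed mcΔ (Θ⊆Δ (inj₂ refl)) (taut (target a ∷ φ ∷ []) (x₀ &ₛ ~ₛ x₁ ⇒ₛ x₀)))
  ... | w′ , w→w′ , refl = ∈⇒~∉ mcΔ (φ-at-successors w′ w→w′)
    (∈-closed mcΔ (Θ⊆Δ (inj₂ refl)) (taut (target a ∷ φ ∷ []) (x₀ &ₛ ~ₛ x₁ ⇒ₛ ~ₛ x₁)))
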